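{- For all positive integers $k$ and $n$, the number of domino tilings of the $kn \times (k+1)n$ rectangle is odd.
   Context: A domino tiling of a region (finite union of unit cells of the square grid) is a tiling by $1\times 2$ and $2\times 1$ rectangles. -}

module Defs where

open import Data.Nat using (ℕ; zero; suc; _<?_)
open import Data.Fin using (Fin; zero; suc; toℕ; fromℕ<; inject₁)
open import Data.Fin.Properties using (_≟_)
open import Data.Vec using (Vec; lookup)
open import Data.List using (List; []; _∷_)
open import Data.List using () renaming (allFin to allFinL)
open import Data.Maybe using (Maybe; just; nothing)
open import Data.Bool using (Bool; true; false; _∧_; T)
open import Data.Product using (Σ; _×_; _,_)
open import Relation.Nullary using (yes; no)
open import Relation.Nullary.Decidable using (⌊_⌋)

-- A domino tiling of the m × n rectangle (m rows, n columns; cells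
-- Fin m × Fin n) is encoded by recording, for every cell, the direction
-- in which its partner cell (the other half of its domino) lies.
data Dir : Set where
  left right up down : Dir

opposite : Dir → Dir
opposite left  = right
opposite right = left
opposite up    = down
opposite down  = up

_≟D_ : Dir → Dir → Bool
left  ≟D left  = true
right ≟D right = true
up    ≟D up    = true
down  ≟D down  = true
_     ≟D _     = false

incF : {m : ℕ} → Fin m → Maybe (Fin m)
incF {m} i with suc (toℕ i) <? m
... | yes p = just (fromℕ< p)
... | no _  = nothing

decF : {m : ℕ} → Fin m → Maybe (Fin m)
decF zero    = nothing
decF (suc i) = just (inject₁ i)

step : {m n : ℕ} → Fin m → Fin n → Dir → Maybe (Fin m × Fin n)
step i j left  with decF j
... | just j' = just (i , j')
... | nothing = nothing
step i j right with incF j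
... | just j' = just (i , j')
... | nothing = nothing
step i j up    with decF i
... | just i' = just (i' , j)
... | nothing = nothing
step i j down  with incF i
... | just i' = just (i' , j)
... | nothing = nothing

Grid : ℕ → ℕ → Set
Grid m n = Vec (Vec Dir n) m

at : {m n : ℕ} → Grid m n → Fin m → Fin n → Dir
at g i j = lookup (lookup g i) j

cellOK : {m n : ℕ} → Grid m n → Fin m → Fin n → Bool
cellOK g i j with step i j (at g i j)
... | nothing        = false
... | just (i' , j') = at g i' j' ≟D opposite (at g i j)

allL : {A : Set} → (A → Bool) → List A → Bool
allL p []       = true
allL p (x ∷ xs) = p x ∧ allL p xs

isTiling : {m n : ℕ} → Grid m n → Bool
isTiling {m} {n} g = allL (λ i → allL (λ j → cellOK g i j) (allFinL n)) (allFinL m)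

Tiling : ℕ → ℕ → Set
Tiling m n = Σ (Grid m n) (λ g → T (isTiling g))

{-# OPTIONS --safe #-}
-- Work modulo 2: the parity of the number of tilings is an F₂-sum, over all ways of giving each
-- cell a direction, of a local consistency condition. Recording on each boundary edge whether a
-- domino crosses it, cutting a rectangle in two becomes an F₂-sum over the flags of the cut.
-- An m × m square with top flags t, left flags s and its other sides closed has an odd number
-- of tilings iff s is the complement of t (peel off the top row and left column and induct).
-- Gluing a column to such a square, an m × (m + 1) block with closed top, bottom and right side
-- has odd count iff its left side is closed too, so appending it does not change the parity:
-- T(m, n + m + 1) ≡ T(m, n). With T(m, n) = T(n, m) and T(m, 0) = 1 this gives
-- T(kn, kn + n) ≡ T(kn, n - 1) = T(n - 1, kn) ≡ T(n - 1, 0) = 1.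
module Submission where

open import Defs
open import Data.Nat using (ℕ; zero; suc; _+_; _*_; _%_; _≤_; _<?_; s≤s)
open import Data.Nat.Properties using (+-comm; +-suc; ≮⇒≥)
open import Data.Fin using (Fin; zero; suc; toℕ; fromℕ<; inject₁)
open import Data.Fin.Properties using (+↔⊎; 0↔⊥; 1↔⊤; toℕ-fromℕ<; toℕ-inject₁)
open import Data.Bool using (Bool; true; false; not; _∧_; _xor_; T)
open import Data.Bool.Properties
  using ( xor-∧-commutativeRing; ∧-commutativeMonoid; ∧-comm; ∧-assoc; ∧-identityʳ
        ; xor-identityʳ; xor-same; not-distribˡ-xor; not-involutive; T-∧; T-≡ )
open import Data.Vec using (Vec; []; _∷_; _++_; zipWith; map; replicate; lookup)
open import Data.Vec.Properties using (map-++; map-∘; map-cong; map-replicate)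
open import Data.List using () renaming (tabulate to tabulateL)
open import Data.Maybe using (Maybe; just; nothing; _>>=_; fromMaybe)
open import Data.Product using (Σ; _×_; _,_; proj₁; proj₂)
open import Data.Sum using (_⊎_; inj₁; inj₂)
open import Data.Sum.Function.Propositional using (_⊎-↔_)
open import Data.Unit using (tt)
open import Data.Empty using (⊥-elim)
open import Function using (_∘_; id)
open import Function.Bundles using (_↔_; mk↔ₛ′; _⇔_; mk⇔; Equivalence)
open import Function.Properties.Inverse using (↔-trans)
open import Function.Properties.Equivalence using () renaming (trans to ⇔-trans; sym to ⇔-sym)
open import Algebra.Bundles using (CommutativeMonoid; CommutativeRing)
open import Algebra.Properties.CommutativeSemigroup (CommutativeMonoid.commutativeSemigroup ∧-commutativeMonoid)
  using () renaming (interchange to ∧-interchange; x∙yz≈y∙xz to ∧-swapˡ)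
open import Relation.Nullary using (yes; no; ¬_)
open import Relation.Binary.PropositionalEquality
import Algebra.Solver.CommutativeMonoid as CommutativeMonoidSolver

module XorSolver = CommutativeMonoidSolver (CommutativeRing.+-commutativeMonoid xor-∧-commutativeRing)
module AndSolver = CommutativeMonoidSolver ∧-commutativeMonoid

open Equivalence using (to; from)

-- Sums modulo 2 over finite families of cells

BigOp : Set → Set → Set
BigOp X A = (A → X) → X

bigDir : {X : Set} → (X → X → X) → BigOp X Dir
bigDir _∙_ f = f left ∙ (f right ∙ (f up ∙ f down))

bigVec : {X A : Set} → BigOp X A → (k : ℕ) → BigOp X (Vec A k)
bigVec op zero    f = f []
bigVec op (suc k) f = op (λ a → bigVec op k (λ v → f (a ∷ v)))

bigGrid : {X : Set} → (X → X → X) → (m n : ℕ) → BigOp X (Grid m n)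
bigGrid _∙_ m n = bigVec (bigVec (bigDir _∙_) n) m

bigDir-hom : {X Y : Set} (_∙_ : X → X → X) (_∘′_ : Y → Y → Y) (h : X → Y) →
             (∀ x y → h (x ∙ y) ≡ h x ∘′ h y) →
             ∀ f → h (bigDir _∙_ f) ≡ bigDir _∘′_ (h ∘ f)
bigDir-hom _∙_ _∘′_ h hom f =
  trans (hom _ _) (cong (h (f left) ∘′_) (trans (hom _ _) (cong (h (f right) ∘′_) (hom _ _))))

bigVec-hom : {X Y A : Set} {opX : BigOp X A} {opY : BigOp Y A} (h : X → Y) →
             (∀ {f g} → (∀ a → f a ≡ g a) → opY f ≡ opY g) →
             (∀ f → h (opX f) ≡ opY (h ∘ f)) →
             ∀ k f → h (bigVec opX k f) ≡ bigVec opY k (h ∘ f)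
bigVec-hom h opY-cong hom zero    f = refl
bigVec-hom h opY-cong hom (suc k) f =
  trans (hom _) (opY-cong (λ a → bigVec-hom h opY-cong hom k (λ v → f (a ∷ v))))

Summation : Set → Set
Summation A = BigOp Bool A

∑Bool : Summation Bool
∑Bool f = f false xor f true

∑Dir : Summation Dir
∑Dir = bigDir _xor_

∑Flags : (m : ℕ) → Summation (Vec Bool m)
∑Flags = bigVec ∑Bool

∑Row : (n : ℕ) → Summation (Vec Dir n)
∑Row = bigVec ∑Dir

∑Grid : (m n : ℕ) → Summation (Grid m n)
∑Grid = bigGrid _xor_

record IsLinear {A : Set} (∑ : Summation A) : Set where
  field
    ∑-cong  : ∀ {f g} → (∀ a → f a ≡ g a) → ∑ f ≡ ∑ g
    ∑-xor   : ∀ f g → ∑ (λ a → f a xor g a) ≡ ∑ f xor ∑ g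
    ∑-false : ∑ (λ _ → false) ≡ false

  ∑-∧ˡ : ∀ c f → ∑ (λ a → c ∧ f a) ≡ c ∧ ∑ f
  ∑-∧ˡ true  f = ∑-cong (λ _ → refl)
  ∑-∧ˡ false f = ∑-false

  ∑-∧ʳ : ∀ c f → ∑ (λ a → f a ∧ c) ≡ ∑ f ∧ c
  ∑-∧ʳ c f = trans (∑-cong (λ a → ∧-comm (f a) c)) (trans (∑-∧ˡ c f) (∧-comm c (∑ f)))

open IsLinear public

record IsFiniteSum {A : Set} (∑ : Summation A) : Set₁ where
  field
    isLinear : IsLinear ∑
    ∑-comm   : ∀ {B} {∑′ : Summation B} → IsLinear ∑′ → (f : A → B → Bool) →
               ∑ (λ a → ∑′ (f a)) ≡ ∑′ (λ b → ∑ (λ a → f a b))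

open IsFiniteSum public

∑Bool-finite : IsFiniteSum ∑Bool
∑Bool-finite = record
  { isLinear = record
    { ∑-cong  = λ h → cong₂ _xor_ (h false) (h true)
    ; ∑-xor   = λ f g → solve 4 (λ a b c d → (a ⊕ c) ⊕ (b ⊕ d) ⊜ (a ⊕ b) ⊕ (c ⊕ d)) refl
                                (f false) (f true) (g false) (g true)
    ; ∑-false = refl
    }
  ; ∑-comm = λ lin f → sym (∑-xor lin (f false) (f true))
  }
  where open XorSolver

∑Dir-finite : IsFiniteSum ∑Dir
∑Dir-finite = record
  { isLinear = record
    { ∑-cong  = λ h → cong₂ _xor_ (h left) (cong₂ _xor_ (h right) (cong₂ _xor_ (h up) (h down)))
    ; ∑-xor   = λ f g →
        solve 8 (λ a b c d e f g h → (a ⊕ e) ⊕ ((b ⊕ f) ⊕ ((c ⊕ g) ⊕ (d ⊕ h)))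
                                   ⊜ (a ⊕ (b ⊕ (c ⊕ d))) ⊕ (e ⊕ (f ⊕ (g ⊕ h)))) refl
          (f left) (f right) (f up) (f down) (g left) (g right) (g up) (g down)
    ; ∑-false = refl
    }
  ; ∑-comm = λ {_} {∑′} lin f →
      sym (bigDir-hom (λ g h b → g b xor h b) _xor_ ∑′ (∑-xor lin) f)
  }
  where open XorSolver

∑Bool-linear : IsLinear ∑Bool
∑Bool-linear = isLinear ∑Bool-finite

∑Dir-linear : IsLinear ∑Dir
∑Dir-linear = isLinear ∑Dir-finite

bigVec-linear : {A : Set} {∑A : Summation A} → IsLinear ∑A → ∀ k → IsLinear (bigVec ∑A k)
bigVec-linear lin zero    = record { ∑-cong = λ h → h [] ; ∑-xor = λ _ _ → refl ; ∑-false = refl }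
bigVec-linear {∑A = ∑A} lin (suc k) = record
  { ∑-cong  = λ h → ∑-cong lin (λ a → ∑-cong linₖ (λ v → h (a ∷ v)))
  ; ∑-xor   = λ f g → trans (∑-cong lin (λ a → ∑-xor linₖ _ _)) (∑-xor lin _ _)
  ; ∑-false = trans (∑-cong lin (λ a → ∑-false linₖ)) (∑-false lin)
  }
  where
  linₖ : IsLinear (bigVec ∑A k)
  linₖ = bigVec-linear lin k

bigVec-finite : {A : Set} {∑A : Summation A} → IsFiniteSum ∑A → ∀ k → IsFiniteSum (bigVec ∑A k)
bigVec-finite {A} {∑A} fin k = record { isLinear = bigVec-linear (isLinear fin) k ; ∑-comm = comm k }
  where
  comm : ∀ k {B} {∑′ : Summation B} → IsLinear ∑′ → (f : Vec A k → B → Bool) →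
         bigVec ∑A k (λ v → ∑′ (f v)) ≡ ∑′ (λ b → bigVec ∑A k (λ v → f v b))
  comm zero    lin f = refl
  comm (suc k) lin f =
    trans (∑-cong (isLinear fin) (λ a → comm k lin (λ v → f (a ∷ v)))) (∑-comm fin lin _)

∑Flags-linear : ∀ m → IsLinear (∑Flags m)
∑Flags-linear = bigVec-linear ∑Bool-linear

∑Row-linear : ∀ n → IsLinear (∑Row n)
∑Row-linear = bigVec-linear ∑Dir-linear

∑Grid-finite : ∀ m n → IsFiniteSum (∑Grid m n)
∑Grid-finite m n = bigVec-finite (bigVec-finite ∑Dir-finite n) m

∑Grid-linear : ∀ m n → IsLinear (∑Grid m n)
∑Grid-linear m n = isLinear (∑Grid-finite m n)

∑-∧-∑ : {A B : Set} {∑A : Summation A} {∑B : Summation B} → IsLinear ∑A → IsLinear ∑B →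
        ∀ f g → ∑A f ∧ ∑B g ≡ ∑A (λ a → ∑B (λ b → f a ∧ g b))
∑-∧-∑ {∑B = ∑B} linA linB f g =
  sym (trans (∑-cong linA (λ a → ∑-∧ˡ linB (f a) g)) (∑-∧ʳ linA (∑B g) f))

bigVec-zipWith : {B C E : Set} {∑B : Summation B} {∑C : Summation C} {∑E : Summation E}
                 (φ : C → E → B) → IsLinear ∑C → IsFiniteSum ∑E →
                 (∀ f → ∑B f ≡ ∑C (λ c → ∑E (λ e → f (φ c e)))) →
                 ∀ m F → bigVec ∑B m F ≡
                         bigVec ∑C m (λ cs → bigVec ∑E m (λ es → F (zipWith φ cs es)))
bigVec-zipWith φ linC finE split zero    F = refl
bigVec-zipWith φ linC finE split (suc m) F =
  trans (split _)
    (∑-cong linC (λ c →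
      trans (∑-cong (isLinear finE) (λ e → bigVec-zipWith φ linC finE split m (λ bs → F (φ c e ∷ bs))))
            (∑-comm finE (bigVec-linear linC m) _)))

bigVec-++ : {A : Set} {∑A : Summation A} → IsLinear ∑A →
            ∀ l n f → bigVec ∑A (l + n) f ≡ bigVec ∑A l (λ u → bigVec ∑A n (λ w → f (u ++ w)))
bigVec-++ lin zero    n f = refl
bigVec-++ lin (suc l) n f = ∑-cong lin (λ a → bigVec-++ lin l n (λ v → f (a ∷ v)))

bigVec-map : {A : Set} {∑A : Summation A} → IsLinear ∑A →
             (π : A → A) → (∀ f → ∑A (f ∘ π) ≡ ∑A f) →
             ∀ n G → bigVec ∑A n (G ∘ map π) ≡ bigVec ∑A n G
bigVec-map lin π inv zero    G = refl
bigVec-map {∑A = ∑A} lin π inv (suc n) G =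
  trans (∑-cong lin (λ a → bigVec-map lin π inv n (λ v → G (π a ∷ v))))
        (inv (λ a → bigVec ∑A n (λ v → G (a ∷ v))))

∑Grid-firstColumn : ∀ m n F →
  ∑Grid m (suc n) F ≡ ∑Row m (λ c → ∑Grid m n (λ g → F (zipWith _∷_ c g)))
∑Grid-firstColumn m n = bigVec-zipWith _∷_ ∑Dir-linear (bigVec-finite ∑Dir-finite n) (λ _ → refl) m

∑Grid-++ : ∀ m l n F →
  ∑Grid m (l + n) F ≡ ∑Grid m l (λ g₁ → ∑Grid m n (λ g₂ → F (zipWith _++_ g₁ g₂)))
∑Grid-++ m l n = bigVec-zipWith _++_ (∑Row-linear l) (bigVec-finite ∑Dir-finite n)
                                (bigVec-++ ∑Dir-linear l n) m

∑Grid-noColumns : ∀ n F → ∑Grid n 0 F ≡ F (replicate n [])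
∑Grid-noColumns zero    F = refl
∑Grid-noColumns (suc n) F = ∑Grid-noColumns n (λ g → F ([] ∷ g))

isOdd : ℕ → Bool
isOdd zero    = false
isOdd (suc n) = not (isOdd n)

isOdd-+ : ∀ m n → isOdd (m + n) ≡ isOdd m xor isOdd n
isOdd-+ zero    n = refl
isOdd-+ (suc m) n = trans (cong not (isOdd-+ m n)) (not-distribˡ-xor (isOdd m) (isOdd n))

isOdd⇒%2≡1 : ∀ n → T (isOdd n) → n % 2 ≡ 1
isOdd⇒%2≡1 (suc zero)    _   = refl
isOdd⇒%2≡1 (suc (suc n)) odd = isOdd⇒%2≡1 n (subst T (not-involutive (isOdd n)) odd)

bit : Bool → ℕ
bit true  = 1
bit false = 0

isOdd-bit : ∀ b → isOdd (bit b) ≡ b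
isOdd-bit true  = refl
isOdd-bit false = refl

Fin-bit↔T : ∀ b → Fin (bit b) ↔ T b
Fin-bit↔T true  = 1↔⊤
Fin-bit↔T false = 0↔⊥

#Grid : (m n : ℕ) → BigOp ℕ (Grid m n)
#Grid = bigGrid _+_

isOdd-#Grid : ∀ m n f → isOdd (#Grid m n f) ≡ ∑Grid m n (isOdd ∘ f)
isOdd-#Grid m n =
  bigVec-hom isOdd (∑-cong (∑Row-linear n))
    (bigVec-hom isOdd (∑-cong ∑Dir-linear) (bigDir-hom _+_ _xor_ isOdd isOdd-+) n) m

Enumerates : {A : Set} → BigOp ℕ A → Set₁
Enumerates {A} count =
  ∀ {P : A → Set} (size : A → ℕ) → (∀ a → Fin (size a) ↔ P a) → Fin (count size) ↔ Σ A P

bigDir-enumerates : Enumerates (bigDir _+_)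
bigDir-enumerates {P} size fin =
  ↔-trans +↔⊎
    (↔-trans (fin left ⊎-↔ ↔-trans +↔⊎ (fin right ⊎-↔ ↔-trans +↔⊎ (fin up ⊎-↔ fin down))) ⊎↔Σ)
  where
  ⊎↔Σ : (P left ⊎ (P right ⊎ (P up ⊎ P down))) ↔ Σ Dir P
  ⊎↔Σ = mk↔ₛ′
    (λ { (inj₁ p) → left , p ; (inj₂ (inj₁ p)) → right , p ; (inj₂ (inj₂ (inj₁ p))) → up , p
       ; (inj₂ (inj₂ (inj₂ p))) → down , p })
    (λ { (left , p) → inj₁ p ; (right , p) → inj₂ (inj₁ p) ; (up , p) → inj₂ (inj₂ (inj₁ p))
       ; (down , p) → inj₂ (inj₂ (inj₂ p)) })
    (λ { (left , p) → refl ; (right , p) → refl ; (up , p) → refl ; (down , p) → refl })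
    (λ { (inj₁ p) → refl ; (inj₂ (inj₁ p)) → refl ; (inj₂ (inj₂ (inj₁ p))) → refl
       ; (inj₂ (inj₂ (inj₂ p))) → refl })

bigVec-enumerates : {A : Set} {count : BigOp ℕ A} →
                    Enumerates count → ∀ k → Enumerates (bigVec count k)
bigVec-enumerates enum zero    size fin =
  ↔-trans (fin []) (mk↔ₛ′ ([] ,_) (λ { ([] , p) → p }) (λ { ([] , p) → refl }) (λ _ → refl))
bigVec-enumerates enum (suc k) size fin =
  ↔-trans (enum _ (λ a → bigVec-enumerates enum k _ (λ v → fin (a ∷ v))))
    (mk↔ₛ′ (λ { (a , v , p) → a ∷ v , p }) (λ { (a ∷ v , p) → a , v , p })
           (λ { (a ∷ v , p) → refl }) (λ { (a , v , p) → refl }))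

#Grid-enumerates : ∀ m n → Enumerates (#Grid m n)
#Grid-enumerates m n = bigVec-enumerates (bigVec-enumerates bigDir-enumerates n) m

T-injective : ∀ {a b : Bool} → T a ⇔ T b → a ≡ b
T-injective {true}  {true}  _  = refl
T-injective {true}  {false} eq = ⊥-elim (to eq tt)
T-injective {false} {true}  eq = ⊥-elim (from eq tt)
T-injective {false} {false} _  = refl

¬T⇒≡false : ∀ {b} → ¬ T b → b ≡ false
¬T⇒≡false {false} _  = refl
¬T⇒≡false {true}  ¬T = ⊥-elim (¬T tt)

infix 4 _≡ᵇ_ _≐_
_≡ᵇ_ : Bool → Bool → Bool
true  ≡ᵇ y = y
false ≡ᵇ y = not y

≡ᵇ⇔≡ : ∀ a b → T (a ≡ᵇ b) ⇔ a ≡ b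
≡ᵇ⇔≡ true  true  = mk⇔ (λ _ → refl) (λ _ → tt)
≡ᵇ⇔≡ true  false = mk⇔ (λ ()) (λ ())
≡ᵇ⇔≡ false true  = mk⇔ (λ ()) (λ ())
≡ᵇ⇔≡ false false = mk⇔ (λ _ → refl) (λ _ → tt)

_≐_ : {n : ℕ} → Vec Bool n → Vec Bool n → Bool
[]       ≐ []       = true
(x ∷ xs) ≐ (y ∷ ys) = (x ≡ᵇ y) ∧ (xs ≐ ys)

≐-refl : ∀ {n} (v : Vec Bool n) → (v ≐ v) ≡ true
≐-refl []          = refl
≐-refl (true ∷ v)  = ≐-refl v
≐-refl (false ∷ v) = ≐-refl v

≐-++ : ∀ {l n} (u₁ v₁ : Vec Bool l) (u₂ v₂ : Vec Bool n) →
       (u₁ ++ u₂ ≐ v₁ ++ v₂) ≡ (u₁ ≐ v₁) ∧ (u₂ ≐ v₂)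
≐-++ []       []       u₂ v₂ = refl
≐-++ (x ∷ u₁) (y ∷ v₁) u₂ v₂ =
  trans (cong ((x ≡ᵇ y) ∧_) (≐-++ u₁ v₁ u₂ v₂)) (sym (∧-assoc (x ≡ᵇ y) _ _))

replicate-++ : ∀ {A : Set} m n (x : A) → replicate (m + n) x ≡ replicate m x ++ replicate n x
replicate-++ zero    n x = refl
replicate-++ (suc m) n x = cong (x ∷_) (replicate-++ m n x)

closed : (n : ℕ) → Vec Bool n
closed n = replicate n false

complementary : {n : ℕ} → Vec Bool n → Vec Bool n → Bool
complementary t s = map not t ≐ s

∑Bool-indicator : ∀ x (f : Bool → Bool) → ∑Bool (λ b → (x ≡ᵇ b) ∧ f b) ≡ f x
∑Bool-indicator true  f = refl
∑Bool-indicator false f = xor-identityʳ (f false)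

bigVec-indicator : ∀ {m} (v : Vec Bool m) (f : Vec Bool m → Bool) →
                   ∑Flags m (λ S → f S ∧ (v ≐ S)) ≡ f v
bigVec-indicator []      f = ∧-identityʳ (f [])
bigVec-indicator {suc m} (x ∷ v) f =
  trans (∑-cong ∑Bool-linear (λ b →
          trans (∑-cong (∑Flags-linear m) (λ S → ∧-swapˡ (f (b ∷ S)) (x ≡ᵇ b) (v ≐ S)))
                (trans (∑-∧ˡ (∑Flags-linear m) (x ≡ᵇ b) (λ S → f (b ∷ S) ∧ (v ≐ S)))
                       (cong ((x ≡ᵇ b) ∧_) (bigVec-indicator v (λ S → f (b ∷ S)))))))
        (∑Bool-indicator x (λ b → f (b ∷ v)))

-- Tilings of a rectangle with prescribed boundary flags

pointing : {n : ℕ} → Dir → Vec Dir n → Vec Bool n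
pointing d = map (_≟D d)

-- The cells of v are consecutive in direction forth; x and y are the flags of the edges
-- through which the line is entered and left.
matchLine : {k : ℕ} → Dir → Dir → Bool → Vec Dir k → Bool → Bool
matchLine back forth x []      y = x ≡ᵇ y
matchLine back forth x (d ∷ v) y = ((d ≟D back) ≡ᵇ x) ∧ matchLine back forth (d ≟D forth) v y

columnsMatch : {m n : ℕ} → Vec Bool n → Grid m n → Vec Bool n → Bool
columnsMatch t []      b = t ≐ b
columnsMatch t (r ∷ g) b = (pointing up r ≐ t) ∧ columnsMatch (pointing down r) g b

rowsMatch : {m n : ℕ} → Grid m n → Vec Bool m → Vec Bool m → Bool
rowsMatch []      []      []      = true
rowsMatch (r ∷ g) (x ∷ s) (y ∷ e) = matchLine left right x r y ∧ rowsMatch g s e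

-- A flag on a boundary edge is true when the domino of the adjacent cell crosses that edge.
tilesWith : {m n : ℕ} → (top bottom : Vec Bool n) (lft rgt : Vec Bool m) → Grid m n → Bool
tilesWith t b s e g = columnsMatch t g b ∧ rowsMatch g s e

parityWith : {m n : ℕ} → (top bottom : Vec Bool n) (lft rgt : Vec Bool m) → Bool
parityWith {m} {n} t b s e = ∑Grid m n (tilesWith t b s e)

parityRect : ℕ → ℕ → Bool
parityRect m n = parityWith (closed n) (closed n) (closed m) (closed m)

columnsMatch-firstColumn : ∀ {m n} x (xs : Vec Bool n) (col : Vec Dir m) (g : Grid m n) y ys →
  columnsMatch (x ∷ xs) (zipWith _∷_ col g) (y ∷ ys) ≡ matchLine up down x col y ∧ columnsMatch xs g ys
columnsMatch-firstColumn x xs []        []      y ys = refl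
columnsMatch-firstColumn x xs (c ∷ col) (r ∷ g) y ys =
  trans (cong ((((c ≟D up) ≡ᵇ x) ∧ (pointing up r ≐ xs)) ∧_)
              (columnsMatch-firstColumn (c ≟D down) (pointing down r) col g y ys))
        (∧-interchange ((c ≟D up) ≡ᵇ x) _ _ _)

rowsMatch-firstColumn : ∀ {m n} (col : Vec Dir m) (g : Grid m n) s e →
  rowsMatch (zipWith _∷_ col g) s e ≡ (pointing left col ≐ s) ∧ rowsMatch g (pointing right col) e
rowsMatch-firstColumn []        []      []      []      = refl
rowsMatch-firstColumn (c ∷ col) (r ∷ g) (x ∷ s) (y ∷ e) =
  trans (cong ((((c ≟D left) ≡ᵇ x) ∧ matchLine left right (c ≟D right) r y) ∧_)
              (rowsMatch-firstColumn col g s e))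
        (∧-interchange ((c ≟D left) ≡ᵇ x) _ _ _)

columnsMatch-++ : ∀ {m l n} (t₁ b₁ : Vec Bool l) (t₂ b₂ : Vec Bool n) (g₁ : Grid m l) (g₂ : Grid m n) →
  columnsMatch (t₁ ++ t₂) (zipWith _++_ g₁ g₂) (b₁ ++ b₂) ≡
  columnsMatch t₁ g₁ b₁ ∧ columnsMatch t₂ g₂ b₂
columnsMatch-++ t₁ b₁ t₂ b₂ []       []       = ≐-++ t₁ b₁ t₂ b₂
columnsMatch-++ t₁ b₁ t₂ b₂ (u ∷ g₁) (w ∷ g₂) =
  trans (cong₂ _∧_
          (trans (cong (_≐ t₁ ++ t₂) (map-++ _ u w)) (≐-++ (pointing up u) t₁ (pointing up w) t₂))
          (trans (cong (λ z → columnsMatch z (zipWith _++_ g₁ g₂) (b₁ ++ b₂)) (map-++ _ u w))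
                 (columnsMatch-++ (pointing down u) b₁ (pointing down w) b₂ g₁ g₂)))
        (∧-interchange (pointing up u ≐ t₁) (pointing up w ≐ t₂)
                       (columnsMatch (pointing down u) g₁ b₁) (columnsMatch (pointing down w) g₂ b₂))

matchLine-++ : ∀ {l n} back forth x (u : Vec Dir l) (w : Vec Dir n) y →
  matchLine back forth x (u ++ w) y ≡
  ∑Bool (λ z → matchLine back forth x u z ∧ matchLine back forth z w y)
matchLine-++ back forth true  []      w y = refl
matchLine-++ back forth false []      w y = sym (xor-identityʳ _)
matchLine-++ back forth x     (d ∷ u) w y =
  trans (cong (((d ≟D back) ≡ᵇ x) ∧_) (matchLine-++ back forth (d ≟D forth) u w y))
        (trans (sym (∑-∧ˡ ∑Bool-linear ((d ≟D back) ≡ᵇ x)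
                      (λ z → matchLine back forth (d ≟D forth) u z ∧ matchLine back forth z w y)))
               (∑-cong ∑Bool-linear (λ z →
                 sym (∧-assoc ((d ≟D back) ≡ᵇ x) (matchLine back forth (d ≟D forth) u z)
                              (matchLine back forth z w y)))))

rowsMatch-++ : ∀ {m l n} (g₁ : Grid m l) (g₂ : Grid m n) s e →
  rowsMatch (zipWith _++_ g₁ g₂) s e ≡ ∑Flags m (λ S → rowsMatch g₁ s S ∧ rowsMatch g₂ S e)
rowsMatch-++         []       []       []      []      = refl
rowsMatch-++ {suc m} (u ∷ g₁) (w ∷ g₂) (x ∷ s) (y ∷ e) =
  trans (cong₂ _∧_ (matchLine-++ left right x u w y) (rowsMatch-++ g₁ g₂ s e))
        (trans (∑-∧-∑ ∑Bool-linear (∑Flags-linear m)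
                 (λ z → matchLine left right x u z ∧ matchLine left right z w y)
                 (λ S → rowsMatch g₁ s S ∧ rowsMatch g₂ S e))
               (∑-cong ∑Bool-linear (λ z → ∑-cong (∑Flags-linear m) (λ S →
                  ∧-interchange (matchLine left right x u z) (matchLine left right z w y)
                                (rowsMatch g₁ s S) (rowsMatch g₂ S e)))))

tilesWith-++ : ∀ {m l n} (t₁ b₁ : Vec Bool l) (t₂ b₂ : Vec Bool n) s e
                 (g₁ : Grid m l) (g₂ : Grid m n) →
  tilesWith (t₁ ++ t₂) (b₁ ++ b₂) s e (zipWith _++_ g₁ g₂) ≡
  ∑Flags m (λ S → tilesWith t₁ b₁ s S g₁ ∧ tilesWith t₂ b₂ S e g₂)
tilesWith-++ {m} t₁ b₁ t₂ b₂ s e g₁ g₂ =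
  trans (cong₂ _∧_ (columnsMatch-++ t₁ b₁ t₂ b₂ g₁ g₂) (rowsMatch-++ g₁ g₂ s e))
        (trans (sym (∑-∧ˡ (∑Flags-linear m)
                          (columnsMatch t₁ g₁ b₁ ∧ columnsMatch t₂ g₂ b₂)
                      (λ S → rowsMatch g₁ s S ∧ rowsMatch g₂ S e)))
               (∑-cong (∑Flags-linear m) (λ S →
                  ∧-interchange (columnsMatch t₁ g₁ b₁) (columnsMatch t₂ g₂ b₂)
                                (rowsMatch g₁ s S) (rowsMatch g₂ S e))))

parityWith-++ : ∀ {m l n} (t₁ b₁ : Vec Bool l) (t₂ b₂ : Vec Bool n) (s e : Vec Bool m) →
  parityWith (t₁ ++ t₂) (b₁ ++ b₂) s e ≡
  ∑Flags m (λ S → parityWith t₁ b₁ s S ∧ parityWith t₂ b₂ S e)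
parityWith-++ {m} {l} {n} t₁ b₁ t₂ b₂ s e = begin
  ∑Grid m (l + n) (tilesWith (t₁ ++ t₂) (b₁ ++ b₂) s e)
    ≡⟨ ∑Grid-++ m l n _ ⟩
  ∑Grid m l (λ g₁ → ∑Grid m n (λ g₂ → tilesWith (t₁ ++ t₂) (b₁ ++ b₂) s e (zipWith _++_ g₁ g₂)))
    ≡⟨ ∑-cong (∑Grid-linear m l) (λ g₁ →
         ∑-cong (∑Grid-linear m n) (tilesWith-++ t₁ b₁ t₂ b₂ s e g₁)) ⟩
  ∑Grid m l (λ g₁ → ∑Grid m n (λ g₂ → ∑Flags m (λ S → T₁ S g₁ ∧ T₂ S g₂)))
    ≡⟨ ∑-cong (∑Grid-linear m l) (λ g₁ →
         trans (∑-comm (∑Grid-finite m n) (∑Flags-linear m) _)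
               (∑-cong (∑Flags-linear m) (λ S → ∑-∧ˡ (∑Grid-linear m n) (T₁ S g₁) (T₂ S)))) ⟩
  ∑Grid m l (λ g₁ → ∑Flags m (λ S → T₁ S g₁ ∧ ∑Grid m n (T₂ S)))
    ≡⟨ ∑-comm (∑Grid-finite m l) (∑Flags-linear m) _ ⟩
  ∑Flags m (λ S → ∑Grid m l (λ g₁ → T₁ S g₁ ∧ ∑Grid m n (T₂ S)))
    ≡⟨ ∑-cong (∑Flags-linear m) (λ S → ∑-∧ʳ (∑Grid-linear m l) (∑Grid m n (T₂ S)) (T₁ S)) ⟩
  ∑Flags m (λ S → parityWith t₁ b₁ s S ∧ parityWith t₂ b₂ S e) ∎
  where
  open ≡-Reasoning
  T₁ : Vec Bool m → Grid m l → Bool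
  T₁ S = tilesWith t₁ b₁ s S
  T₂ : Vec Bool m → Grid m n → Bool
  T₂ S = tilesWith t₂ b₂ S e

-- Reflection in the main diagonal

reflectDir : Dir → Dir
reflectDir left  = up
reflectDir right = down
reflectDir up    = left
reflectDir down  = right

reflectDir-≟D : ∀ x d → (reflectDir x ≟D reflectDir d) ≡ (x ≟D d)
reflectDir-≟D left  = λ { left → refl ; right → refl ; up → refl ; down → refl }
reflectDir-≟D right = λ { left → refl ; right → refl ; up → refl ; down → refl }
reflectDir-≟D up    = λ { left → refl ; right → refl ; up → refl ; down → refl }
reflectDir-≟D down  = λ { left → refl ; right → refl ; up → refl ; down → refl }

∑Dir-reflectDir : ∀ f → ∑Dir (f ∘ reflectDir) ≡ ∑Dir f
∑Dir-reflectDir f =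
  solve 4 (λ l r u d → u ⊕ (d ⊕ (l ⊕ r)) ⊜ l ⊕ (r ⊕ (u ⊕ d))) refl (f left) (f right) (f up) (f down)
  where open XorSolver

reflect : {m n : ℕ} → Grid m n → Grid n m
reflect {n = n} []      = replicate n []
reflect         (r ∷ g) = zipWith _∷_ (map reflectDir r) (reflect g)

pointing-reflect : ∀ {n} d (r : Vec Dir n) → pointing (reflectDir d) (map reflectDir r) ≡ pointing d r
pointing-reflect d r = trans (sym (map-∘ _ reflectDir r)) (map-cong (λ x → reflectDir-≟D x d) r)

matchLine-reflect : ∀ {k} back forth x (v : Vec Dir k) y →
  matchLine (reflectDir back) (reflectDir forth) x (map reflectDir v) y ≡ matchLine back forth x v y
matchLine-reflect back forth x []      y = refl
matchLine-reflect back forth x (d ∷ v) y =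
  cong₂ (λ a b → (a ≡ᵇ x) ∧ b) (reflectDir-≟D d back)
        (trans (cong (λ z → matchLine (reflectDir back) (reflectDir forth) z (map reflectDir v) y)
                     (reflectDir-≟D d forth))
               (matchLine-reflect back forth (d ≟D forth) v y))

rowsMatch-noColumns : ∀ n (s e : Vec Bool n) → rowsMatch (replicate n []) s e ≡ (s ≐ e)
rowsMatch-noColumns zero    []      []      = refl
rowsMatch-noColumns (suc n) (x ∷ s) (y ∷ e) = cong ((x ≡ᵇ y) ∧_) (rowsMatch-noColumns n s e)

columnsMatch-noColumns : ∀ n → columnsMatch [] (replicate n []) [] ≡ true
columnsMatch-noColumns zero    = refl
columnsMatch-noColumns (suc n) = columnsMatch-noColumns n

columnsMatch-reflect : ∀ {m n} (t : Vec Bool n) (g : Grid m n) b →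
                       columnsMatch t g b ≡ rowsMatch (reflect g) t b
columnsMatch-reflect {n = n} t []      b = sym (rowsMatch-noColumns n t b)
columnsMatch-reflect         t (r ∷ g) b = sym (
  trans (rowsMatch-firstColumn (map reflectDir r) (reflect g) t b)
        (cong₂ _∧_ (cong (_≐ t) (pointing-reflect up r))
                   (trans (cong (λ z → rowsMatch (reflect g) z b) (pointing-reflect down r))
                          (sym (columnsMatch-reflect (pointing down r) g b)))))

rowsMatch-reflect : ∀ {m n} (g : Grid m n) s e → rowsMatch g s e ≡ columnsMatch s (reflect g) e
rowsMatch-reflect {n = n} []      []      []      = sym (columnsMatch-noColumns n)
rowsMatch-reflect         (r ∷ g) (x ∷ s) (y ∷ e) = sym (
  trans (columnsMatch-firstColumn x s (map reflectDir r) (reflect g) y e)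
        (cong₂ _∧_ (matchLine-reflect left right x r y) (sym (rowsMatch-reflect g s e))))

tilesWith-reflect : ∀ {m n} (t b : Vec Bool n) (s e : Vec Bool m) g →
  tilesWith t b s e g ≡ tilesWith s e t b (reflect g)
tilesWith-reflect t b s e g =
  trans (cong₂ _∧_ (columnsMatch-reflect t g b) (rowsMatch-reflect g s e))
        (∧-comm (rowsMatch (reflect g) t b) (columnsMatch s (reflect g) e))

∑Grid-reflect : ∀ m n F → ∑Grid m n (F ∘ reflect) ≡ ∑Grid n m F
∑Grid-reflect zero    n F = sym (∑Grid-noColumns n F)
∑Grid-reflect (suc m) n F =
  trans (∑-cong (∑Row-linear n) (λ r →
           ∑Grid-reflect m n (λ h → F (zipWith _∷_ (map reflectDir r) h))))
        (trans (bigVec-map ∑Dir-linear reflectDir ∑Dir-reflectDir n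
                  (λ c → ∑Grid n m (λ h → F (zipWith _∷_ c h))))
               (sym (∑Grid-firstColumn n m F)))

parityRect-sym : ∀ m n → parityRect m n ≡ parityRect n m
parityRect-sym m n =
  trans (∑-cong (∑Grid-linear m n) (tilesWith-reflect (closed n) (closed n) (closed m) (closed m)))
        (∑Grid-reflect m n (tilesWith (closed m) (closed m) (closed n) (closed n)))

-- Squares, by peeling off a hook

Balanced : (Bool → Bool → Bool) → Set
Balanced w = (w true true ≡ false) × (w true false ≡ w false true)

cornerOK : Bool → Bool → Dir → Bool
cornerOK t₀ s₀ c = ((c ≟D up) ≡ᵇ t₀) ∧ ((c ≟D left) ≡ᵇ s₀)

corner : Bool → Bool → (Bool → Bool → Bool) → Bool
corner t₀ s₀ w = ∑Dir (λ c → cornerOK t₀ s₀ c ∧ w (c ≟D right) (c ≟D down))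

corner-balanced : ∀ t₀ s₀ w → Balanced w → corner t₀ s₀ w ≡ (not t₀ ≡ᵇ s₀) ∧ w false false
corner-balanced true  true  w _ = refl
corner-balanced true  false w _ = xor-identityʳ _
corner-balanced false true  w _ = xor-identityʳ _
corner-balanced false false w (_ , w₁₀≡w₀₁) =
  trans (cong (_xor w false true) w₁₀≡w₀₁) (xor-same (w false true))

hookOK : {m : ℕ} → Vec Bool m → Vec Bool m → Bool → Bool → Vec Dir m → Vec Dir m → Bool
hookOK t s x y r col =
  (pointing up r ≐ t) ∧ matchLine left right x r false ∧
  matchLine up down y col false ∧ (pointing left col ≐ s)

-- Removing the corner, the rest r of the top row and the rest col of the left column from a
-- square leaves a square with top flags pointing down r and left flags pointing right col, whose
-- parity is the last factor by induction. x and y say whether the corner points into r and col.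
hookSum : (m : ℕ) → Bool → Bool → Vec Bool m → Vec Bool m → Bool
hookSum m x y t s =
  ∑Row m (λ r → ∑Row m (λ col →
    hookOK t s x y r col ∧ complementary (pointing down r) (pointing right col)))

junction : Bool → Bool → Bool → Bool → Dir → Dir → Bool
junction x y a b r₀ c₀ =
  ((r₀ ≟D up) ≡ᵇ a) ∧ ((r₀ ≟D left) ≡ᵇ x) ∧
  ((c₀ ≟D up) ≡ᵇ y) ∧ ((c₀ ≟D left) ≡ᵇ b) ∧
  (not (r₀ ≟D down) ≡ᵇ (c₀ ≟D right))

hookStep : Bool → Bool → Bool → Bool → (Bool → Bool → Bool) → Bool
hookStep x y a b w =
  ∑Dir (λ r₀ → ∑Dir (λ c₀ → junction x y a b r₀ c₀ ∧ w (r₀ ≟D right) (c₀ ≟D down)))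

hookStep-balanced : ∀ a b w → Balanced (λ x y → hookStep x y a b w)
hookStep-balanced true  true  w = refl , refl
hookStep-balanced true  false w = refl , refl
hookStep-balanced false true  w = refl , refl
hookStep-balanced false false w = refl , xor-identityʳ _

hookStep-ff : ∀ a b w → Balanced w → hookStep false false a b w ≡ (not a ≡ᵇ b) ∧ w false false
hookStep-ff true  true  w _ = refl
hookStep-ff true  false w _ = trans (xor-identityʳ _) (xor-identityʳ _)
hookStep-ff false true  w _ = xor-identityʳ _
hookStep-ff false false w (_ , w₁₀≡w₀₁) =
  trans (cong (_xor w false true) (trans (xor-identityʳ _) w₁₀≡w₀₁)) (xor-same (w false true))

hookSum-suc : ∀ m x y a b (t s : Vec Bool m) →
  hookSum (suc m) x y (a ∷ t) (b ∷ s) ≡ hookStep x y a b (λ x′ y′ → hookSum m x′ y′ t s)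
hookSum-suc m x y a b t s =
  ∑-cong ∑Dir-linear (λ r₀ →
    trans (∑-comm (bigVec-finite ∑Dir-finite m) ∑Dir-linear (λ r c₀ → ∑Row m (Φ r₀ r c₀)))
          (∑-cong ∑Dir-linear (factorJunction r₀)))
  where
  Φ : Dir → Vec Dir m → Dir → Vec Dir m → Bool
  Φ r₀ r c₀ col = hookOK (a ∷ t) (b ∷ s) x y (r₀ ∷ r) (c₀ ∷ col) ∧
                  complementary (pointing down (r₀ ∷ r)) (pointing right (c₀ ∷ col))
  Ψ : Dir → Vec Dir m → Dir → Vec Dir m → Bool
  Ψ r₀ r c₀ col = hookOK t s (r₀ ≟D right) (c₀ ≟D down) r col ∧
                  complementary (pointing down r) (pointing right col)
  rearrange : ∀ r₀ r c₀ col → Φ r₀ r c₀ col ≡ junction x y a b r₀ c₀ ∧ Ψ r₀ r c₀ col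
  rearrange r₀ r c₀ col =
    solve 10 (λ a₁ b₁ a₂ b₂ a₃ b₃ a₄ b₄ a₅ b₅ →
                ((a₁ ⊕ b₁) ⊕ ((a₂ ⊕ b₂) ⊕ ((a₃ ⊕ b₃) ⊕ (a₄ ⊕ b₄)))) ⊕ (a₅ ⊕ b₅)
              ⊜ (a₁ ⊕ (a₂ ⊕ (a₃ ⊕ (a₄ ⊕ a₅)))) ⊕ ((b₁ ⊕ (b₂ ⊕ (b₃ ⊕ b₄))) ⊕ b₅)) refl
      ((r₀ ≟D up) ≡ᵇ a) (pointing up r ≐ t)
      ((r₀ ≟D left) ≡ᵇ x) (matchLine left right (r₀ ≟D right) r false)
      ((c₀ ≟D up) ≡ᵇ y) (matchLine up down (c₀ ≟D down) col false)
      ((c₀ ≟D left) ≡ᵇ b) (pointing left col ≐ s)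
      (not (r₀ ≟D down) ≡ᵇ (c₀ ≟D right)) (complementary (pointing down r) (pointing right col))
    where open AndSolver
  factorJunction : ∀ r₀ c₀ → ∑Row m (λ r → ∑Row m (Φ r₀ r c₀)) ≡
                             junction x y a b r₀ c₀ ∧ hookSum m (r₀ ≟D right) (c₀ ≟D down) t s
  factorJunction r₀ c₀ =
    trans (∑-cong (∑Row-linear m) (λ r →
             trans (∑-cong (∑Row-linear m) (rearrange r₀ r c₀))
                   (∑-∧ˡ (∑Row-linear m) (junction x y a b r₀ c₀) (Ψ r₀ r c₀))))
          (∑-∧ˡ (∑Row-linear m) (junction x y a b r₀ c₀) (λ r → ∑Row m (Ψ r₀ r c₀)))

hookSum-balanced : ∀ m (t s : Vec Bool m) → Balanced (λ x y → hookSum m x y t s)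
hookSum-balanced zero    []      []      = refl , refl
hookSum-balanced (suc m) (a ∷ t) (b ∷ s) =
  trans (hookSum-suc m true true a b t s) (proj₁ stepBalanced) ,
  trans (hookSum-suc m true false a b t s)
        (trans (proj₂ stepBalanced) (sym (hookSum-suc m false true a b t s)))
  where
  stepBalanced : Balanced (λ x y → hookStep x y a b (λ x′ y′ → hookSum m x′ y′ t s))
  stepBalanced = hookStep-balanced a b (λ x y → hookSum m x y t s)

hookSum-ff : ∀ m (t s : Vec Bool m) → hookSum m false false t s ≡ complementary t s
hookSum-ff zero    []      []      = refl
hookSum-ff (suc m) (a ∷ t) (b ∷ s) =
  trans (hookSum-suc m false false a b t s)
        (trans (hookStep-ff a b (λ x y → hookSum m x y t s) (hookSum-balanced m t s))
               (cong ((not a ≡ᵇ b) ∧_) (hookSum-ff m t s)))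

tilesWith-hook : ∀ {m} t₀ (t : Vec Bool m) s₀ s c r col (g : Grid m m) →
  tilesWith (t₀ ∷ t) (closed (suc m)) (s₀ ∷ s) (closed (suc m)) ((c ∷ r) ∷ zipWith _∷_ col g) ≡
  (cornerOK t₀ s₀ c ∧ hookOK t s (c ≟D right) (c ≟D down) r col) ∧
  tilesWith (pointing down r) (closed m) (pointing right col) (closed m) g
tilesWith-hook {m} t₀ t s₀ s c r col g =
  trans (cong₂ (λ u v → ((((c ≟D up) ≡ᵇ t₀) ∧ (pointing up r ≐ t)) ∧ u) ∧
                        ((((c ≟D left) ≡ᵇ s₀) ∧ matchLine left right (c ≟D right) r false) ∧ v))
               (columnsMatch-firstColumn (c ≟D down) (pointing down r) col g false (closed m))
               (rowsMatch-firstColumn col g s (closed m)))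
        (solve 8 (λ a b c d e f g h → ((a ⊕ b) ⊕ (c ⊕ d)) ⊕ ((e ⊕ f) ⊕ (g ⊕ h))
                                   ⊜ ((a ⊕ e) ⊕ (b ⊕ (f ⊕ (c ⊕ g)))) ⊕ (d ⊕ h)) refl
          ((c ≟D up) ≡ᵇ t₀) (pointing up r ≐ t)
          (matchLine up down (c ≟D down) col false) (columnsMatch (pointing down r) g (closed m))
          ((c ≟D left) ≡ᵇ s₀) (matchLine left right (c ≟D right) r false)
          (pointing left col ≐ s) (rowsMatch g (pointing right col) (closed m)))
  where open AndSolver

parityWith-square : ∀ m (t s : Vec Bool m) → parityWith t (closed m) s (closed m) ≡ complementary t s
parityWith-square zero    []       []       = refl
parityWith-square (suc m) (t₀ ∷ t) (s₀ ∷ s) = begin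
  parityWith (t₀ ∷ t) (closed (suc m)) (s₀ ∷ s) (closed (suc m))
    ≡⟨ ∑-cong ∑Dir-linear (λ c → ∑-cong (∑Row-linear m) (λ r →
         ∑Grid-firstColumn m m (λ rows → Φ ((c ∷ r) ∷ rows)))) ⟩
  ∑Dir (λ c → ∑Row m (λ r → ∑Row m (λ col → ∑Grid m m (λ g → Φ ((c ∷ r) ∷ zipWith _∷_ col g)))))
    ≡⟨ ∑-cong ∑Dir-linear (λ c → ∑-cong (∑Row-linear m) (λ r → ∑-cong (∑Row-linear m) (inner c r))) ⟩
  ∑Dir (λ c → ∑Row m (λ r → ∑Row m (λ col → (cornerOK t₀ s₀ c ∧ H c r col) ∧ C r col)))
    ≡⟨ ∑-cong ∑Dir-linear factor ⟩
  corner t₀ s₀ (λ x y → hookSum m x y t s)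
    ≡⟨ corner-balanced t₀ s₀ (λ x y → hookSum m x y t s) (hookSum-balanced m t s) ⟩
  (not t₀ ≡ᵇ s₀) ∧ hookSum m false false t s
    ≡⟨ cong ((not t₀ ≡ᵇ s₀) ∧_) (hookSum-ff m t s) ⟩
  complementary (t₀ ∷ t) (s₀ ∷ s) ∎
  where
  open ≡-Reasoning
  Φ : Grid (suc m) (suc m) → Bool
  Φ = tilesWith (t₀ ∷ t) (closed (suc m)) (s₀ ∷ s) (closed (suc m))
  H : Dir → Vec Dir m → Vec Dir m → Bool
  H c = hookOK t s (c ≟D right) (c ≟D down)
  C : Vec Dir m → Vec Dir m → Bool
  C r col = complementary (pointing down r) (pointing right col)
  inner : ∀ c r col →
          ∑Grid m m (λ g → Φ ((c ∷ r) ∷ zipWith _∷_ col g)) ≡ (cornerOK t₀ s₀ c ∧ H c r col) ∧ C r col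
  inner c r col =
    trans (∑-cong (∑Grid-linear m m) (tilesWith-hook t₀ t s₀ s c r col))
          (trans (∑-∧ˡ (∑Grid-linear m m) (cornerOK t₀ s₀ c ∧ H c r col) _)
                 (cong ((cornerOK t₀ s₀ c ∧ H c r col) ∧_)
                       (parityWith-square m (pointing down r) (pointing right col))))
  factor : ∀ c → ∑Row m (λ r → ∑Row m (λ col → (cornerOK t₀ s₀ c ∧ H c r col) ∧ C r col)) ≡
                 cornerOK t₀ s₀ c ∧ hookSum m (c ≟D right) (c ≟D down) t s
  factor c =
    trans (∑-cong (∑Row-linear m) (λ r →
             trans (∑-cong (∑Row-linear m) (λ col → ∧-assoc (cornerOK t₀ s₀ c) (H c r col) (C r col)))
                   (∑-∧ˡ (∑Row-linear m) (cornerOK t₀ s₀ c) (λ col → H c r col ∧ C r col))))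
          (∑-∧ˡ (∑Row-linear m) (cornerOK t₀ s₀ c) (λ r → ∑Row m (λ col → H c r col ∧ C r col)))

-- Periodicity in the number of columns

-- An open right side forces every cell of the column to point right.
parityWith-openColumn : ∀ m (S : Vec Bool m) →
  parityWith (false ∷ []) (false ∷ []) S (replicate m true) ≡ (closed m ≐ S)
parityWith-openColumn zero    []       = refl
parityWith-openColumn (suc m) (s₀ ∷ S) =
  trans (∑-cong ∑Dir-linear (λ c →
           trans (∑-cong (∑Grid-linear m 1) (topCell c))
                 (∑-∧ˡ (∑Grid-linear m 1) ((c ≟D right) ∧ not s₀) Rest)))
        (trans (xor-identityʳ _) (cong (not s₀ ∧_) (parityWith-openColumn m S)))
  where
  opened : Vec Bool m
  opened = replicate m true
  Rest : Grid m 1 → Bool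
  Rest = tilesWith (false ∷ []) (false ∷ []) S opened
  below : Bool → Grid m 1 → Bool
  below x rows = columnsMatch (x ∷ []) rows (false ∷ [])
  rearrange : ∀ p a b q → p ∧ ((a ∧ b) ∧ q) ≡ (b ∧ a) ∧ (p ∧ q)
  rearrange = solve 4 (λ p a b q → p ⊕ ((a ⊕ b) ⊕ q) ⊜ (b ⊕ a) ⊕ (p ⊕ q)) refl
    where open AndSolver
  topCell : ∀ c rows →
    tilesWith (false ∷ []) (false ∷ []) (s₀ ∷ S) (true ∷ opened) ((c ∷ []) ∷ rows) ≡
    ((c ≟D right) ∧ not s₀) ∧ Rest rows
  topCell left  rows = rearrange (below false rows) s₀       false (rowsMatch rows S opened)
  topCell right rows = rearrange (below false rows) (not s₀) true  (rowsMatch rows S opened)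
  topCell up    rows = refl
  topCell down  rows = rearrange (below true rows)  (not s₀) false (rowsMatch rows S opened)

parityWith-block : ∀ m (S : Vec Bool m) →
                   parityWith (closed (suc m)) (closed (suc m)) S (closed m) ≡ (closed m ≐ S)
parityWith-block m S = begin
  parityWith (closed (suc m)) (closed (suc m)) S (closed m)
    ≡⟨ parityWith-++ (false ∷ []) (false ∷ []) (closed m) (closed m) S (closed m) ⟩
  ∑Flags m (λ S′ → Column S′ ∧ parityWith (closed m) (closed m) S′ (closed m))
    ≡⟨ ∑-cong (∑Flags-linear m) (λ S′ → cong (Column S′ ∧_)
         (trans (parityWith-square m (closed m) S′) (cong (_≐ S′) (map-replicate not false m)))) ⟩
  ∑Flags m (λ S′ → Column S′ ∧ (replicate m true ≐ S′))
    ≡⟨ bigVec-indicator (replicate m true) Column ⟩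
  Column (replicate m true)
    ≡⟨ parityWith-openColumn m S ⟩
  (closed m ≐ S) ∎
  where
  open ≡-Reasoning
  Column : Vec Bool m → Bool
  Column = parityWith (false ∷ []) (false ∷ []) S

parityRect-periodic : ∀ m n → parityRect m (n + suc m) ≡ parityRect m n
parityRect-periodic m n = begin
  parityRect m (n + suc m)
    ≡⟨ cong (λ f → parityWith f f (closed m) (closed m)) (replicate-++ n (suc m) false) ⟩
  parityWith (closed n ++ closed (suc m)) (closed n ++ closed (suc m)) (closed m) (closed m)
    ≡⟨ parityWith-++ (closed n) (closed n) (closed (suc m)) (closed (suc m)) (closed m) (closed m) ⟩
  ∑Flags m (λ S → Left S ∧ parityWith (closed (suc m)) (closed (suc m)) S (closed m))
    ≡⟨ ∑-cong (∑Flags-linear m) (λ S → cong (Left S ∧_) (parityWith-block m S)) ⟩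
  ∑Flags m (λ S → Left S ∧ (closed m ≐ S))
    ≡⟨ bigVec-indicator (closed m) Left ⟩
  parityRect m n ∎
  where
  open ≡-Reasoning
  Left : Vec Bool m → Bool
  Left = parityWith (closed n) (closed n) (closed m)

parityRect-noColumns : ∀ m → parityRect m 0 ≡ true
parityRect-noColumns m =
  trans (∑Grid-noColumns m (tilesWith [] [] (closed m) (closed m)))
        (cong₂ _∧_ (columnsMatch-noColumns m)
                   (trans (rowsMatch-noColumns m (closed m) (closed m)) (≐-refl (closed m))))

parityRect-multiple : ∀ m q → parityRect m (q * suc m) ≡ true
parityRect-multiple m zero    = parityRect-noColumns m
parityRect-multiple m (suc q) =
  trans (cong (parityRect m) (+-comm (suc m) (q * suc m)))
        (trans (parityRect-periodic m (q * suc m)) (parityRect-multiple m q))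

parityRect-consecutiveMultiples : ∀ k a → parityRect (k * suc a) ((k + 1) * suc a) ≡ true
parityRect-consecutiveMultiples k a = begin
  parityRect (k * suc a) ((k + 1) * suc a)
    ≡⟨ cong (parityRect (k * suc a)) (trans (cong (_* suc a) (+-comm k 1)) (sym (+-suc a (k * suc a)))) ⟩
  parityRect (k * suc a) (a + suc (k * suc a))
    ≡⟨ parityRect-periodic (k * suc a) a ⟩
  parityRect (k * suc a) a
    ≡⟨ parityRect-sym (k * suc a) a ⟩
  parityRect a (k * suc a)
    ≡⟨ parityRect-multiple a k ⟩
  true ∎
  where open ≡-Reasoning

-- Local consistency of a direction grid

≟D-refl : ∀ d → T (d ≟D d)
≟D-refl left  = tt
≟D-refl right = tt
≟D-refl up    = tt
≟D-refl down  = tt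

≟D-sound : ∀ x d → T (x ≟D d) → x ≡ d
≟D-sound left  = λ { left _ → refl ; right () ; up () ; down () }
≟D-sound right = λ { left () ; right _ → refl ; up () ; down () }
≟D-sound up    = λ { left () ; right () ; up _ → refl ; down () }
≟D-sound down  = λ { left () ; right () ; up () ; down _ → refl }

∀-suc⇔ : {P : ℕ → Set} → (P 0 × (∀ J → P (suc J))) ⇔ (∀ J → P J)
∀-suc⇔ = mk⇔ (λ { (p₀ , pₛ) zero → p₀ ; (p₀ , pₛ) (suc J) → pₛ J }) (λ p → p 0 , p ∘ suc)

_!?_ : {A : Set} {n : ℕ} → Vec A n → ℕ → Maybe A
[]       !? _     = nothing
(x ∷ xs) !? zero  = just x
(x ∷ xs) !? suc j = xs !? j

!?-toℕ : ∀ {A : Set} {n} (v : Vec A n) (j : Fin n) → v !? toℕ j ≡ just (lookup v j)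
!?-toℕ (x ∷ v) zero    = refl
!?-toℕ (x ∷ v) (suc j) = !?-toℕ v j

!?-outside : ∀ {A : Set} {n} (v : Vec A n) {J} → n ≤ J → v !? J ≡ nothing
!?-outside []      _         = refl
!?-outside (x ∷ v) (s≤s n≤J) = !?-outside v n≤J

pointsTo : Maybe Dir → Dir → Bool
pointsTo nothing  d = false
pointsTo (just x) d = x ≟D d

flagAt : {n : ℕ} → Vec Bool n → ℕ → Bool
flagAt t J = fromMaybe false (t !? J)

flagAt-pointing : ∀ {n} d (r : Vec Dir n) J → flagAt (pointing d r) J ≡ pointsTo (r !? J) d
flagAt-pointing d []      J       = refl
flagAt-pointing d (x ∷ r) zero    = refl
flagAt-pointing d (x ∷ r) (suc J) = flagAt-pointing d r J

flagAt-closed : ∀ n J → flagAt (closed n) J ≡ false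
flagAt-closed zero    J       = refl
flagAt-closed (suc n) zero    = refl
flagAt-closed (suc n) (suc J) = flagAt-closed n J

≐⇔ : ∀ {n} (u v : Vec Bool n) → T (u ≐ v) ⇔ (∀ J → flagAt u J ≡ flagAt v J)
≐⇔ []      []      = mk⇔ (λ _ _ → refl) (λ _ → tt)
≐⇔ (x ∷ u) (y ∷ v) = mk⇔
  (λ ok → let (head , rest) = to T-∧ ok in to ∀-suc⇔ (to (≡ᵇ⇔≡ x y) head , to (≐⇔ u v) rest))
  (λ eq → from T-∧ (from (≡ᵇ⇔≡ x y) (eq 0) , from (≐⇔ u v) (eq ∘ suc)))

cellAt : {m n : ℕ} → Grid m n → ℕ → ℕ → Maybe Dir
cellAt g I J = g !? I >>= (_!? J)

points : {m n : ℕ} → Grid m n → Dir → ℕ → ℕ → Bool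
points g d I J = pointsTo (cellAt g I J) d

points-at : ∀ {m n} (g : Grid m n) d i j → points g d (toℕ i) (toℕ j) ≡ (at g i j ≟D d)
points-at g d i j rewrite !?-toℕ g i | !?-toℕ (lookup g i) j = refl

points-outsideRow : ∀ {m n} (g : Grid m n) d {I} J → m ≤ I → points g d I J ≡ false
points-outsideRow g d J m≤I rewrite !?-outside g m≤I = refl

points-outsideColumn : ∀ {m n} (g : Grid m n) d I {J} → n ≤ J → points g d I J ≡ false
points-outsideColumn []      d I       n≤J = refl
points-outsideColumn (r ∷ g) d zero    n≤J rewrite !?-outside r n≤J = refl
points-outsideColumn (r ∷ g) d (suc I) n≤J = points-outsideColumn g d I n≤J

-- Cells outside the rectangle point nowhere, so these conditions also close the right and
-- bottom sides.
record Consistent {m n : ℕ} (g : Grid m n) : Set where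
  field
    leftClosed : ∀ I → points g left I 0 ≡ false
    horizontal : ∀ I J → points g left I (suc J) ≡ points g right I J
    topClosed  : ∀ J → points g up 0 J ≡ false
    vertical   : ∀ I J → points g up (suc I) J ≡ points g down I J

matchLine⇔ : ∀ {n} x (v : Vec Dir n) →
  T (matchLine left right x v false) ⇔
  ((pointsTo (v !? 0) left ≡ x) × (∀ J → pointsTo (v !? suc J) left ≡ pointsTo (v !? J) right))
matchLine⇔ true  []      = mk⇔ (λ ()) (λ { (() , _) })
matchLine⇔ false []      = mk⇔ (λ _ → refl , λ _ → refl) (λ _ → tt)
matchLine⇔ x     (d ∷ v) = mk⇔
  (λ ok → let (head , rest) = to T-∧ ok
              (next , tail) = to (matchLine⇔ (d ≟D right) v) rest
          in to (≡ᵇ⇔≡ _ x) head , to ∀-suc⇔ (next , tail))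
  (λ { (head , links) → from T-∧ (from (≡ᵇ⇔≡ _ x) head ,
                                  from (matchLine⇔ (d ≟D right) v) (from ∀-suc⇔ links)) })

rowsMatch⇔ : ∀ {m n} (g : Grid m n) →
  T (rowsMatch g (closed m) (closed m)) ⇔
  ((∀ I → points g left I 0 ≡ false) × (∀ I J → points g left I (suc J) ≡ points g right I J))
rowsMatch⇔ []      = mk⇔ (λ _ → (λ _ → refl) , (λ _ _ → refl)) (λ _ → tt)
rowsMatch⇔ (r ∷ g) = mk⇔
  (λ ok → let (line , rest) = to T-∧ ok
              (first , links) = to (matchLine⇔ false r) line
              (firsts , linkss) = to (rowsMatch⇔ g) rest
          in to ∀-suc⇔ (first , firsts) , to ∀-suc⇔ (links , linkss))
  (λ { (firsts , links) → from T-∧ (from (matchLine⇔ false r) (firsts 0 , links 0) ,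
                                    from (rowsMatch⇔ g) (firsts ∘ suc , links ∘ suc)) })

columnsMatch⇔ : ∀ {m n} (t : Vec Bool n) (g : Grid m n) →
  T (columnsMatch t g (closed n)) ⇔
  ((∀ J → points g up 0 J ≡ flagAt t J) × (∀ I J → points g up (suc I) J ≡ points g down I J))
columnsMatch⇔ {n = n} t [] = mk⇔
  (λ ok → (λ J → sym (trans (to (≐⇔ t (closed n)) ok J) (flagAt-closed n J))) , (λ _ _ → refl))
  (λ { (top , _) → from (≐⇔ t (closed n)) (λ J → trans (sym (top J)) (sym (flagAt-closed n J))) })
columnsMatch⇔ t (r ∷ g) = mk⇔
  (λ ok → let (row , rest) = to T-∧ ok
              (top , links) = to (columnsMatch⇔ (pointing down r) g) rest
          in (λ J → trans (sym (flagAt-pointing up r J)) (to (≐⇔ (pointing up r) t) row J)) ,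
             to ∀-suc⇔ ((λ J → trans (top J) (flagAt-pointing down r J)) , links))
  (λ { (top , links) → from T-∧
         (from (≐⇔ (pointing up r) t) (λ J → trans (flagAt-pointing up r J) (top J)) ,
          from (columnsMatch⇔ (pointing down r) g)
               ((λ J → trans (links 0 J) (sym (flagAt-pointing down r J))) , links ∘ suc)) })

tilesWith⇔consistent : ∀ {m n} (g : Grid m n) →
  T (tilesWith (closed n) (closed n) (closed m) (closed m) g) ⇔ Consistent g
tilesWith⇔consistent {m} {n} g = mk⇔
  (λ ok → let (cols , rows) = to T-∧ ok
              (top , vertical) = to (columnsMatch⇔ (closed n) g) cols
              (leftClosed , horizontal) = to (rowsMatch⇔ g) rows
          in record { leftClosed = leftClosed ; horizontal = horizontal
                    ; topClosed = λ J → trans (top J) (flagAt-closed n J) ; vertical = vertical })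
  (λ c → let open Consistent c in
         from T-∧ (from (columnsMatch⇔ (closed n) g)
                         ((λ J → trans (topClosed J) (sym (flagAt-closed n J))) , vertical) ,
                   from (rowsMatch⇔ g) (leftClosed , horizontal)))

pairedAt : {m n : ℕ} → Grid m n → Dir → ℕ → ℕ → Bool
pairedAt g left  I       zero    = false
pairedAt g left  I       (suc J) = points g right I J
pairedAt g right I       J       = points g left I (suc J)
pairedAt g up    zero    J       = false
pairedAt g up    (suc I) J       = points g down I J
pairedAt g down  I       J       = points g up (suc I) J

AllPaired : {m n : ℕ} → Grid m n → Set
AllPaired g = ∀ d I J → T (points g d I J) → T (pairedAt g d I J)

consistent⇔allPaired : ∀ {m n} (g : Grid m n) → Consistent g ⇔ AllPaired g
consistent⇔allPaired g = mk⇔ paired consistent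
  where
  paired : Consistent g → AllPaired g
  paired c left  I zero    p = ⊥-elim (subst T (Consistent.leftClosed c I) p)
  paired c left  I (suc J) p = from T-≡ (trans (sym (Consistent.horizontal c I J)) (to T-≡ p))
  paired c right I J       p = from T-≡ (trans (Consistent.horizontal c I J) (to T-≡ p))
  paired c up    zero J    p = ⊥-elim (subst T (Consistent.topClosed c J) p)
  paired c up    (suc I) J p = from T-≡ (trans (sym (Consistent.vertical c I J)) (to T-≡ p))
  paired c down  I J       p = from T-≡ (trans (Consistent.vertical c I J) (to T-≡ p))
  consistent : AllPaired g → Consistent g
  consistent p = record
    { leftClosed = λ I → ¬T⇒≡false (p left I 0)
    ; horizontal = λ I J → T-injective (mk⇔ (p left I (suc J)) (p right I J))
    ; topClosed  = λ J → ¬T⇒≡false (p up 0 J)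
    ; vertical   = λ I J → T-injective (mk⇔ (p up (suc I) J) (p down I J))
    }

data IncView {n : ℕ} (j : Fin n) : Maybe (Fin n) → Set where
  inside  : ∀ j′ → toℕ j′ ≡ suc (toℕ j) → IncView j (just j′)
  outside : n ≤ suc (toℕ j) → IncView j nothing

incView : ∀ {n} (j : Fin n) → IncView j (incF j)
incView {n} j with suc (toℕ j) <? n
... | yes p = inside (fromℕ< p) (toℕ-fromℕ< p)
... | no ¬p = outside (≮⇒≥ ¬p)

pointsBack : {m n : ℕ} → Grid m n → Maybe (Fin m × Fin n) → Dir → Bool
pointsBack g nothing          d = false
pointsBack g (just (i′ , j′)) d = at g i′ j′ ≟D opposite d

cellOK-pointsBack : ∀ {m n} (g : Grid m n) i j →
                    cellOK g i j ≡ pointsBack g (step i j (at g i j)) (at g i j)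
cellOK-pointsBack g i j with step i j (at g i j)
... | nothing = refl
... | just _  = refl

pointsBack-step : ∀ {m n} (g : Grid m n) i j d →
                  pointsBack g (step i j d) d ≡ pairedAt g d (toℕ i) (toℕ j)
pointsBack-step g i zero    left = refl
pointsBack-step g i (suc j) left =
  sym (trans (cong (points g right (toℕ i)) (sym (toℕ-inject₁ j))) (points-at g right i (inject₁ j)))
pointsBack-step g i j right with incF j | incView j
... | just j′ | inside .j′ j′≡1+j =
  sym (trans (cong (points g left (toℕ i)) (sym j′≡1+j)) (points-at g left i j′))
... | nothing | outside n≤1+j = sym (points-outsideColumn g left (toℕ i) n≤1+j)
pointsBack-step g zero    j up = refl
pointsBack-step g (suc i) j up =
  sym (trans (cong (λ I → points g down I (toℕ j)) (sym (toℕ-inject₁ i)))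
             (points-at g down (inject₁ i) j))
pointsBack-step g i j down with incF i | incView i
... | just i′ | inside .i′ i′≡1+i =
  sym (trans (cong (λ I → points g up I (toℕ j)) (sym i′≡1+i)) (points-at g up i′ j))
... | nothing | outside m≤1+i = sym (points-outsideRow g up (toℕ j) m≤1+i)

cellOK≡pairedAt : ∀ {m n} (g : Grid m n) i j → cellOK g i j ≡ pairedAt g (at g i j) (toℕ i) (toℕ j)
cellOK≡pairedAt g i j = trans (cellOK-pointsBack g i j) (pointsBack-step g i j (at g i j))

allL-tabulate⇔ : ∀ {A : Set} {n} (p : A → Bool) (f : Fin n → A) →
                 T (allL p (tabulateL f)) ⇔ (∀ i → T (p (f i)))
allL-tabulate⇔ {n = zero}  p f = mk⇔ (λ _ ()) (λ _ → tt)
allL-tabulate⇔ {n = suc n} p f = mk⇔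
  (λ ok → let (head , rest) = to T-∧ ok
          in λ { zero → head ; (suc i) → to (allL-tabulate⇔ p (f ∘ suc)) rest i })
  (λ all → from T-∧ (all zero , from (allL-tabulate⇔ p (f ∘ suc)) (all ∘ suc)))

CellsPaired : {m n : ℕ} → Grid m n → Set
CellsPaired g = ∀ i j → T (pairedAt g (at g i j) (toℕ i) (toℕ j))

isTiling⇔cellsPaired : ∀ {m n} (g : Grid m n) → T (isTiling g) ⇔ CellsPaired g
isTiling⇔cellsPaired {m} {n} g = mk⇔
  (λ ok i j → subst T (cellOK≡pairedAt g i j)
                 (to (allL-tabulate⇔ _ id) (to (allL-tabulate⇔ _ id) ok i) j))
  (λ paired → from (allL-tabulate⇔ _ id) (λ i → from (allL-tabulate⇔ _ id) (λ j →
                subst T (sym (cellOK≡pairedAt g i j)) (paired i j))))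

cellsPaired⇔allPaired : ∀ {m n} (g : Grid m n) → CellsPaired g ⇔ AllPaired g
cellsPaired⇔allPaired {m} {n} g = mk⇔ extend restrict
  where
  restrict : AllPaired g → CellsPaired g
  restrict paired i j =
    paired (at g i j) (toℕ i) (toℕ j) (subst T (sym (points-at g (at g i j) i j)) (≟D-refl (at g i j)))
  inRange : CellsPaired g → ∀ d i j →
            T (points g d (toℕ i) (toℕ j)) → T (pairedAt g d (toℕ i) (toℕ j))
  inRange paired d i j p with refl ← ≟D-sound (at g i j) d (subst T (points-at g d i j) p) = paired i j
  extend : CellsPaired g → AllPaired g
  extend paired d I J p with I <? m | J <? n
  ... | no I≮m  | _       = ⊥-elim (subst T (points-outsideRow g d J (≮⇒≥ I≮m)) p)
  ... | yes _   | no J≮n  = ⊥-elim (subst T (points-outsideColumn g d I (≮⇒≥ J≮n)) p)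
  ... | yes I<m | yes J<n =
    subst₂ (λ I J → T (pairedAt g d I J)) (toℕ-fromℕ< I<m) (toℕ-fromℕ< J<n)
      (inRange paired d (fromℕ< I<m) (fromℕ< J<n)
        (subst₂ (λ I J → T (points g d I J)) (sym (toℕ-fromℕ< I<m)) (sym (toℕ-fromℕ< J<n)) p))

isTiling≡tilesWith : ∀ {m n} (g : Grid m n) →
                     isTiling g ≡ tilesWith (closed n) (closed n) (closed m) (closed m) g
isTiling≡tilesWith g = T-injective chain
  where
  chain : T (isTiling g) ⇔ T (tilesWith _ _ _ _ g)
  chain = ⇔-trans (isTiling⇔cellsPaired g) (⇔-trans (cellsPaired⇔allPaired g)
            (⇔-trans (⇔-sym (consistent⇔allPaired g)) (⇔-sym (tilesWith⇔consistent g))))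

tilingCount : ℕ → ℕ → ℕ
tilingCount m n = #Grid m n (bit ∘ isTiling)

Fin-tilingCount↔Tiling : ∀ m n → Fin (tilingCount m n) ↔ Tiling m n
Fin-tilingCount↔Tiling m n = #Grid-enumerates m n (bit ∘ isTiling) (Fin-bit↔T ∘ isTiling)

isOdd-tilingCount : ∀ m n → isOdd (tilingCount m n) ≡ parityRect m n
isOdd-tilingCount m n =
  trans (isOdd-#Grid m n (bit ∘ isTiling))
        (∑-cong (∑Grid-linear m n) (λ g → trans (isOdd-bit (isTiling g)) (isTiling≡tilesWith g)))

tilingCount-odd : ∀ m n → parityRect m n ≡ true → tilingCount m n % 2 ≡ 1
tilingCount-odd m n odd =
  isOdd⇒%2≡1 (tilingCount m n) (subst T (sym (trans (isOdd-tilingCount m n) odd)) tt)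

corollary4p2 : (k n : ℕ) → 1 ≤ k → 1 ≤ n →
    Σ ℕ (λ N → (Fin N ↔ Tiling (k * n) ((k + 1) * n)) × (N % 2 ≡ 1))
corollary4p2 k zero    _ ()
corollary4p2 k (suc a) _ _ =
  tilingCount m n , Fin-tilingCount↔Tiling m n , tilingCount-odd m n (parityRect-consecutiveMultiples k a)
  where
  m n : ℕ
  m = k * suc a
  n = (k + 1) * suc a
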